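{- The numbers of negative pentagons (5-cycles) and negative hexagons (6-cycles) in the six signed Petersen graphs are: $+P$: 0 negative pentagons, 0 negative hexagons; $P_1$: 4 and 4; $P_{2,2}$: 6 and 6; $P_{2,3}$ (which is switching isomorphic to $-P_1$): 8 and 4; $P_{3,2}$: 6 and 10; $P_{3,3}$ (which is switching isomorphic to $-P$): 12 and 0.
   Context: The Petersen graph $P$ has vertices $v_{ij}$ indexed by the 2-element subsets $\{i,j\}$ of $\{1,\dots,5\}$, with $v_{ij}v_{kl}$ an edge iff $\{i,j\}\cap\{k,l\}=\emptyset$. A signature is $\sigma:E(P)\to\{+,-\}$; the sign of a cycle is the product of the signs of its edges, and a cycle is negative if its sign is $-$. Switching by $\zeta:V\to\{+,-\}$ gives $\sigma^\zeta(vw)=\zeta(v)\sigma(vw)\zeta(w)$; switching isomorphism means isomorphism (sign-preserving graph isomorphism) to a switching. The distance between two edges is their distance in the line graph; in $P$ two disjoint edges have distance 2 if some edge joins an endpoint of one to an endpoint of the other, and distance 3 otherwise. $+P$: all edges positive; $-P$: all negative; $P_1$: exactly one negative edge; $P_{2,2}$ / $P_{2,3}$: exactly two negative edges at distance 2 / 3; $P_{3,2}$: exactly three negative edges forming alternate edges of a hexagon; $P_{3,3}$: exactly three negative edges pairwise at distance 3. -}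

module Defs where

open import Data.Bool using (Bool; true; false; T; not; _∧_)
open import Data.Nat using (ℕ; _<ᵇ_)
open import Data.Fin using (Fin; toℕ)
open import Data.Fin.Properties using (_≟_)
open import Data.Product using (Σ; _×_; _,_; proj₁; proj₂; ∃; ∃-syntax)
open import Data.Sum using (_⊎_)
open import Data.List using (List; []; _∷_; _++_; [_]; zip; length; foldr; map)
open import Data.List.Membership.Propositional using (_∈_)
open import Data.List.Relation.Unary.All using (All)
open import Data.List.Relation.Unary.Any using (Any)
open import Data.List.Relation.Unary.AllPairs using (AllPairs)
open import Data.List.Relation.Unary.Unique.Propositional using (Unique)
open import Relation.Nullary using (¬_)
open import Relation.Nullary.Decidable using (⌊_⌋)
open import Relation.Binary.PropositionalEquality using (_≡_)
open import Function using (_∘_; id)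
open import Function.Bundles using (_⇔_)

data Sign : Set where
  plus minus : Sign

_·_ : Sign → Sign → Sign
plus  · s = s
minus · plus = minus
minus · minus = plus

neg : Sign → Sign
neg plus = minus
neg minus = plus

-- The Petersen graph: vertices are the 2-element subsets {i,j} of
-- {1,..,5} (here Fin 5), written as pairs (i , j) with i < j.

V : Set
V = Σ (Fin 5 × Fin 5) (λ p → T (toℕ (proj₁ p) <ᵇ toℕ (proj₂ p)))

_≠ᵇ_ : Fin 5 → Fin 5 → Bool
i ≠ᵇ j = not ⌊ i ≟ j ⌋

adj : V → V → Bool
adj ((i , j) , _) ((k , l) , _) = (i ≠ᵇ k) ∧ (i ≠ᵇ l) ∧ (j ≠ᵇ k) ∧ (j ≠ᵇ l)

Adjacent : V → V → Set
Adjacent v w = T (adj v w)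

-- Signatures.  A signature σ : E(P) → {+,-} is represented by a
-- function on ordered pairs of vertices; only its values on adjacent
-- pairs matter, and it must be symmetric there.

Signature : Set
Signature = V → V → Sign

Symmetric : Signature → Set
Symmetric σ = ∀ v w → Adjacent v w → σ v w ≡ σ w v

negSig : Signature → Signature
negSig σ v w = neg (σ v w)

AllPositive : Signature → Set
AllPositive σ = ∀ v w → Adjacent v w → σ v w ≡ plus

AllNegative : Signature → Set
AllNegative σ = ∀ v w → Adjacent v w → σ v w ≡ minus

IsEdge : V × V → Set
IsEdge (a , b) = Adjacent a b

SameEdge : V × V → V → V → Set
SameEdge (a , b) v w = (v ≡ a × w ≡ b) ⊎ (v ≡ b × w ≡ a)

NegativeEdgesAre : Signature → List (V × V) → Set
NegativeEdgesAre σ es =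
  All IsEdge es ×
  (∀ v w → Adjacent v w → (σ v w ≡ minus ⇔ Any (λ e → SameEdge e v w) es))

DisjointEdges : V × V → V × V → Set
DisjointEdges (a , b) (c , d) =
  ¬ a ≡ c × ¬ a ≡ d × ¬ b ≡ c × ¬ b ≡ d

Joined : V × V → V × V → Set
Joined (a , b) (c , d) =
  Adjacent a c ⊎ Adjacent a d ⊎ Adjacent b c ⊎ Adjacent b d

-- distance 2 / 3 in the line graph of P, for disjoint edges of P
Dist2 : V × V → V × V → Set
Dist2 e f = DisjointEdges e f × Joined e f

Dist3 : V × V → V × V → Set
Dist3 e f = DisjointEdges e f × ¬ Joined e f

-- Cycles.  A k-cycle is given by a list of k distinct vertices
-- v₀ … v_{k-1} with v_i v_{i+1} (indices mod k) edges.

cyclePairs : List V → List (V × V)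
cyclePairs []       = []
cyclePairs (v ∷ vs) = zip (v ∷ vs) (vs ++ [ v ])

IsCycle : ℕ → List V → Set
IsCycle k vs =
  length vs ≡ k × Unique vs × All (λ p → Adjacent (proj₁ p) (proj₂ p)) (cyclePairs vs)

cycleSign : Signature → List V → Sign
cycleSign σ vs = foldr (λ p s → σ (proj₁ p) (proj₂ p) · s) plus (cyclePairs vs)

InCycle : List V → V → V → Set
InCycle vs v w = ((v , w) ∈ cyclePairs vs) ⊎ ((w , v) ∈ cyclePairs vs)

SameCycle : List V → List V → Set
SameCycle c d = ∀ v w → (InCycle c v w ⇔ InCycle d v w)

NegCycle : Signature → ℕ → List V → Set
NegCycle σ k c = IsCycle k c × cycleSign σ c ≡ minus

NumNegCycles : Signature → ℕ → ℕ → Set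
NumNegCycles σ k n =
  Σ (List (List V)) λ cs →
    length cs ≡ n ×
    All (NegCycle σ k) cs ×
    AllPairs (λ c d → ¬ SameCycle c d) cs ×
    (∀ c → NegCycle σ k c → Any (SameCycle c) cs)

IsPlusP : Signature → Set
IsPlusP = AllPositive

IsMinusP : Signature → Set
IsMinusP = AllNegative

IsP1 : Signature → Set
IsP1 σ = ∃[ e ] NegativeEdgesAre σ (e ∷ [])

IsMinusP1 : Signature → Set
IsMinusP1 σ = IsP1 (negSig σ)

IsP22 : Signature → Set
IsP22 σ = ∃[ e ] ∃[ f ] (Dist2 e f × NegativeEdgesAre σ (e ∷ f ∷ []))

IsP23 : Signature → Set
IsP23 σ = ∃[ e ] ∃[ f ] (Dist3 e f × NegativeEdgesAre σ (e ∷ f ∷ []))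

IsP32 : Signature → Set
IsP32 σ = ∃[ v₀ ] ∃[ v₁ ] ∃[ v₂ ] ∃[ v₃ ] ∃[ v₄ ] ∃[ v₅ ]
  (IsCycle 6 (v₀ ∷ v₁ ∷ v₂ ∷ v₃ ∷ v₄ ∷ v₅ ∷ []) ×
   NegativeEdgesAre σ ((v₀ , v₁) ∷ (v₂ , v₃) ∷ (v₄ , v₅) ∷ []))

IsP33 : Signature → Set
IsP33 σ = ∃[ e ] ∃[ f ] ∃[ g ]
  (Dist3 e f × Dist3 e g × Dist3 f g × NegativeEdgesAre σ (e ∷ f ∷ g ∷ []))

-- Switching isomorphism: τ is isomorphic (via an automorphism φ of P)
-- to the switching σ^ζ of σ.

SwitchingIsomorphic : Signature → Signature → Set
SwitchingIsomorphic σ τ =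
  Σ (V → Sign) λ ζ → Σ (V → V) λ φ → Σ (V → V) λ ψ →
    (∀ v → ψ (φ v) ≡ v) × (∀ v → φ (ψ v) ≡ v) ×
    (∀ v w → adj (φ v) (φ w) ≡ adj v w) ×
    (∀ v w → Adjacent v w → τ (φ v) (φ w) ≡ (ζ v · σ v w) · ζ w)

-- A signature in which exactly the listed edges are negative agrees on every edge with the
-- concrete signature `negativeOn es`, so every count reduces to evaluating cycle signs of a
-- concrete signature.  Cycle signs are invariant under rotating and reflecting the vertex
-- sequence, so it is enough to evaluate one representative of each of the 12 pentagons and
-- 10 hexagons of P; that these lists are complete, and the counts for every admissible
-- placement of the negative edges, are checked by computation.
--
-- Two edges at distance 3 avoid a common point m of {0,…,4}, and the three edges avoiding m
-- are pairwise at distance 3.  Switching at the six vertices not containing m negates every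
-- edge except these three, which turns P₃,₃ into −P and P₂,₃ into −P₁ whose positive edge is
-- the third edge avoiding m.  Relabellings of {0,…,4} act on P by automorphisms, transitively
-- on edges, and so carry this edge onto the positive edge of any given −P₁.
module Submission where

open import Defs
open import Data.Bool using (Bool; T; _∧_; if_then_else_)
open import Data.Bool.Properties using (T?; T-irrelevant; ∧-assoc; ∧-comm)
open import Data.Empty using (⊥-elim)
open import Data.Fin using (Fin; toℕ)
open import Data.Fin.Patterns using (0F; 1F; 2F; 3F; 4F)
import Data.Fin.Properties as Fin
open import Data.Nat using (ℕ; zero; suc; _≤_; _<ᵇ_)
import Data.Nat.Properties as ℕ
open import Data.Maybe using (fromMaybe)
open import Data.Product using (_×_; Σ; _,_; proj₁; proj₂; swap)
import Data.Product as Product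
open import Data.Product.Properties using (≡-dec)
open import Data.Sum using (_⊎_; inj₁; inj₂)
import Data.Sum as Sum
open import Data.List
  using (List; []; _∷_; _++_; [_]; _∷ʳ_; length; foldr; map; zip; reverse; concatMap; filter; cartesianProduct; allFin)
  renaming (find to first)
import Data.List.Properties as List
open import Data.List.Membership.Propositional using (_∈_; find)
open import Data.List.Membership.Propositional.Properties
  using (∈-++⁻; ∈-allFin; ∈-map⁺; ∈-map⁻; ∈-concatMap⁺; ∈-filter⁺; ∈-filter⁻; ∈-cartesianProduct⁺)
import Data.List.Membership.DecPropositional as DecMembership
open import Data.List.Relation.Unary.All using (All; []; _∷_; all?)
import Data.List.Relation.Unary.All as All
open import Data.List.Relation.Unary.All.Properties using (all-filter)
import Data.List.Relation.Unary.All.Properties as All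
open import Data.List.Relation.Unary.Any using (Any; here; there; any?)
import Data.List.Relation.Unary.Any as Any
import Data.List.Relation.Unary.Any.Properties as Any
open import Data.List.Relation.Unary.AllPairs using (AllPairs; allPairs?)
import Data.List.Relation.Unary.AllPairs as AllPairs
import Data.List.Relation.Unary.AllPairs.Properties as AllPairs
open import Data.List.Relation.Unary.Unique.DecPropositional using (unique?)
open import Data.List.Relation.Binary.Permutation.Propositional using (_↭_; ↭-refl; ↭-sym; ↭-trans; module PermutationReasoning)
import Data.List.Relation.Binary.Permutation.Propositional as ↭
open import Data.List.Relation.Binary.Permutation.Propositional.Properties using (∷↭∷ʳ; ↭-reverse; ∈-resp-↭)
open import Function using (_∘_)
open import Function.Bundles using (_⇔_; mk⇔; Equivalence)
open import Function.Construct.Composition using (_⇔-∘_)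
open import Function.Construct.Symmetry using (⇔-sym)
open import Function.Definitions using (Injective)
open import Relation.Binary.Definitions using (DecidableEquality)
open import Relation.Binary.PropositionalEquality
  using (_≡_; _≢_; refl; sym; trans; cong; cong₂; subst; subst₂; module ≡-Reasoning)
open import Relation.Nullary using (¬_; Dec; yes; no; does)
open import Relation.Nullary.Decidable using (map′; ¬?; _×-dec_; _⊎-dec_; _→-dec_; from-yes)

_≟ˢ_ : DecidableEquality Sign
plus  ≟ˢ plus  = yes refl
plus  ≟ˢ minus = no λ ()
minus ≟ˢ plus  = no λ ()
minus ≟ˢ minus = yes refl

x·yz≡y·xz : ∀ s t u → s · (t · u) ≡ t · (s · u)
x·yz≡y·xz plus  t     u = refl
x·yz≡y·xz minus plus  u = refl
x·yz≡y·xz minus minus u = refl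

neg-involutive : ∀ s → neg (neg s) ≡ s
neg-involutive plus  = refl
neg-involutive minus = refl

sign-ext : ∀ {s t} → (s ≡ minus ⇔ t ≡ minus) → s ≡ t
sign-ext {plus}  {plus}  _   = refl
sign-ext {plus}  {minus} s⇔t = Equivalence.from s⇔t refl
sign-ext {minus} {plus}  s⇔t = sym (Equivalence.to s⇔t refl)
sign-ext {minus} {minus} _   = refl

signOf : Signature → List (V × V) → Sign
signOf σ = foldr (λ p s → σ (proj₁ p) (proj₂ p) · s) plus

SymmetricEverywhere : Signature → Set
SymmetricEverywhere σ = ∀ v w → σ v w ≡ σ w v

Agree : Signature → Signature → Set
Agree σ σ′ = ∀ v w → Adjacent v w → σ v w ≡ σ′ v w

signOf-↭ : ∀ σ {ps qs} → ps ↭ qs → signOf σ ps ≡ signOf σ qs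
signOf-↭ σ ↭.refl                 = refl
signOf-↭ σ (↭.prep (v , w) ps↭qs) = cong (σ v w ·_) (signOf-↭ σ ps↭qs)
signOf-↭ σ (↭.swap (v , w) (x , y) ps↭qs) =
  trans (cong (λ s → σ v w · (σ x y · s)) (signOf-↭ σ ps↭qs)) (x·yz≡y·xz (σ v w) (σ x y) _)
signOf-↭ σ (↭.trans ps↭qs qs↭rs)  = trans (signOf-↭ σ ps↭qs) (signOf-↭ σ qs↭rs)

signOf-swap : ∀ {σ} → SymmetricEverywhere σ → ∀ ps → signOf σ (map swap ps) ≡ signOf σ ps
signOf-swap σ-sym []             = refl
signOf-swap σ-sym ((v , w) ∷ ps) = cong₂ _·_ (σ-sym w v) (signOf-swap σ-sym ps)

signOf-agree : ∀ {σ σ′} → Agree σ σ′ → ∀ {ps} → All IsEdge ps → signOf σ ps ≡ signOf σ′ ps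
signOf-agree σ≈σ′ []                      = refl
signOf-agree σ≈σ′ {(v , w) ∷ _} (vw ∷ ps) = cong₂ _·_ (σ≈σ′ v w vw) (signOf-agree σ≈σ′ ps)

walk : V → List V → List (V × V)
walk a []       = []
walk a (b ∷ bs) = (a , b) ∷ walk b bs

cyclePairs-walk : ∀ x xs → cyclePairs (x ∷ xs) ≡ walk x (xs ∷ʳ x)
cyclePairs-walk x = go x
  where
  go : ∀ a xs → zip (a ∷ xs) (xs ∷ʳ x) ≡ walk a (xs ∷ʳ x)
  go a []       = refl
  go a (b ∷ bs) = cong ((a , b) ∷_) (go b bs)

walk-∷ʳ : ∀ a bs b c → walk a ((bs ∷ʳ b) ∷ʳ c) ≡ walk a (bs ∷ʳ b) ∷ʳ (b , c)
walk-∷ʳ a []        b c = refl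
walk-∷ʳ a (b′ ∷ bs) b c = cong ((a , b′) ∷_) (walk-∷ʳ b′ bs b c)

walk-reverse : ∀ a bs z → walk z (reverse bs ∷ʳ a) ≡ reverse (map swap (walk a (bs ∷ʳ z)))
walk-reverse a []       z = refl
walk-reverse a (b ∷ bs) z = begin
  walk z (reverse (b ∷ bs) ∷ʳ a)                  ≡⟨ cong (λ xs → walk z (xs ∷ʳ a)) (List.unfold-reverse b bs) ⟩
  walk z ((reverse bs ∷ʳ b) ∷ʳ a)                 ≡⟨ walk-∷ʳ z (reverse bs) b a ⟩
  walk z (reverse bs ∷ʳ b) ∷ʳ (b , a)             ≡⟨ cong (_∷ʳ (b , a)) (walk-reverse b bs z) ⟩
  reverse (map swap (walk b (bs ∷ʳ z))) ∷ʳ (b , a) ≡⟨ List.unfold-reverse (b , a) (map swap (walk b (bs ∷ʳ z))) ⟨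
  reverse (map swap (walk a ((b ∷ bs) ∷ʳ z)))     ∎
  where open ≡-Reasoning

rotate : List V → List V
rotate []       = []
rotate (x ∷ xs) = xs ∷ʳ x

cyclePairs-rotate : ∀ c → cyclePairs (rotate c) ↭ cyclePairs c
cyclePairs-rotate []           = ↭-refl
cyclePairs-rotate (x ∷ [])     = ↭-refl
cyclePairs-rotate (x ∷ y ∷ ys) = begin
  cyclePairs (y ∷ ys ∷ʳ x)     ≡⟨ cyclePairs-walk y (ys ∷ʳ x) ⟩
  walk y ((ys ∷ʳ x) ∷ʳ y)      ≡⟨ walk-∷ʳ y ys x y ⟩
  walk y (ys ∷ʳ x) ∷ʳ (x , y)  ↭⟨ ∷↭∷ʳ (x , y) _ ⟨
  walk x ((y ∷ ys) ∷ʳ x)       ≡⟨ cyclePairs-walk x (y ∷ ys) ⟨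
  cyclePairs (x ∷ y ∷ ys)      ∎
  where open PermutationReasoning

cyclePairs-reverse : ∀ c → cyclePairs (reverse c) ↭ map swap (cyclePairs c)
cyclePairs-reverse []       = ↭-refl
cyclePairs-reverse (x ∷ xs) = begin
  cyclePairs (reverse (x ∷ xs))            ≡⟨ cong cyclePairs (List.unfold-reverse x xs) ⟩
  cyclePairs (rotate (x ∷ reverse xs))     ↭⟨ cyclePairs-rotate (x ∷ reverse xs) ⟩
  cyclePairs (x ∷ reverse xs)              ≡⟨ cyclePairs-walk x (reverse xs) ⟩
  walk x (reverse xs ∷ʳ x)                 ≡⟨ walk-reverse x xs x ⟩
  reverse (map swap (walk x (xs ∷ʳ x)))    ↭⟨ ↭-reverse _ ⟩
  map swap (walk x (xs ∷ʳ x))              ≡⟨ cong (map swap) (cyclePairs-walk x xs) ⟨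
  map swap (cyclePairs (x ∷ xs))           ∎
  where open PermutationReasoning

rotations : ℕ → List V → List (List V)
rotations zero    c = []
rotations (suc n) c = c ∷ rotations n (rotate c)

variants : List V → List (List V)
variants c = rotations (length c) c ++ rotations (length c) (reverse c)

∈-rotations : ∀ n {c d} → d ∈ rotations n c → cyclePairs d ↭ cyclePairs c
∈-rotations (suc n)     (here refl) = ↭-refl
∈-rotations (suc n) {c} (there d∈)  = ↭-trans (∈-rotations n d∈) (cyclePairs-rotate c)

∈-variants : ∀ {c d} → d ∈ variants c →
  cyclePairs d ↭ cyclePairs c ⊎ cyclePairs d ↭ map swap (cyclePairs c)
∈-variants {c} d∈ with ∈-++⁻ (rotations (length c) c) d∈
... | inj₁ d∈rot = inj₁ (∈-rotations (length c) d∈rot)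
... | inj₂ d∈rot = inj₂ (↭-trans (∈-rotations (length c) d∈rot) (cyclePairs-reverse c))

cycleSign-variant : ∀ {σ} → SymmetricEverywhere σ → ∀ {c d} → d ∈ variants c → cycleSign σ d ≡ cycleSign σ c
cycleSign-variant {σ} σ-sym {c} d∈ with ∈-variants {c} d∈
... | inj₁ d↭c  = signOf-↭ σ d↭c
... | inj₂ d↭c˘ = trans (signOf-↭ σ d↭c˘) (signOf-swap σ-sym (cyclePairs c))

InPairs : List (V × V) → V → V → Set
InPairs ps v w = (v , w) ∈ ps ⊎ (w , v) ∈ ps

inPairs-↭ : ∀ {ps qs v w} → ps ↭ qs → InPairs ps v w → InPairs qs v w
inPairs-↭ ps↭qs = Sum.map (∈-resp-↭ ps↭qs) (∈-resp-↭ ps↭qs)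

inPairs-swap : ∀ {ps v w} → InPairs (map swap ps) v w ⇔ InPairs ps v w
inPairs-swap = mk⇔ (Sum.swap ∘ Sum.map unswap unswap) (Sum.swap ∘ Sum.map (∈-map⁺ swap) (∈-map⁺ swap))
  where
  unswap : ∀ {ps p} → swap p ∈ map swap ps → p ∈ ps
  unswap swap-p∈ with ∈-map⁻ swap swap-p∈
  ... | _ , q∈ , refl = q∈

samePairs-↭ : ∀ {ps qs v w} → ps ↭ qs → InPairs ps v w ⇔ InPairs qs v w
samePairs-↭ ps↭qs = mk⇔ (inPairs-↭ ps↭qs) (inPairs-↭ (↭-sym ps↭qs))

sameCycle-variant : ∀ {c d} → d ∈ variants c → SameCycle c d
sameCycle-variant {c} d∈ v w with ∈-variants {c} d∈
... | inj₁ d↭c  = ⇔-sym (samePairs-↭ d↭c)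
... | inj₂ d↭c˘ = ⇔-sym (inPairs-swap ⇔-∘ samePairs-↭ d↭c˘)

_≟ⱽ_ : DecidableEquality V
(p , x) ≟ⱽ (q , y) =
  map′ (λ { refl → cong (p ,_) (T-irrelevant x y) }) (cong proj₁) (≡-dec Fin._≟_ Fin._≟_ p q)

_≟ᴾ_ : DecidableEquality (V × V)
_≟ᴾ_ = ≡-dec _≟ⱽ_ _≟ⱽ_

open DecMembership _≟ᴾ_ using () renaming (_∈?_ to _∈ᴾ?_)
open DecMembership (List.≡-dec _≟ⱽ_) using () renaming (_∈?_ to _∈ᶜ?_)
open DecMembership (Fin._≟_ {5}) using () renaming (_∉?_ to _∉ᶠ?_)

vtx : (i j : Fin 5) {i<j : T (toℕ i <ᵇ toℕ j)} → V
vtx i j {i<j} = (i , j) , i<j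

v01 v02 v03 v04 v12 v13 v14 v23 v24 v34 : V
v01 = vtx 0F 1F
v02 = vtx 0F 2F
v03 = vtx 0F 3F
v04 = vtx 0F 4F
v12 = vtx 1F 2F
v13 = vtx 1F 3F
v14 = vtx 1F 4F
v23 = vtx 2F 3F
v24 = vtx 2F 4F
v34 = vtx 3F 4F

allV : List V
allV = v01 ∷ v02 ∷ v03 ∷ v04 ∷ v12 ∷ v13 ∷ v14 ∷ v23 ∷ v24 ∷ v34 ∷ []

∈-allV : ∀ v → v ∈ allV
∈-allV ((0F , 1F) , _) = here refl
∈-allV ((0F , 2F) , _) = there (here refl)
∈-allV ((0F , 3F) , _) = there (there (here refl))
∈-allV ((0F , 4F) , _) = there (there (there (here refl)))
∈-allV ((1F , 2F) , _) = there (there (there (there (here refl))))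
∈-allV ((1F , 3F) , _) = there (there (there (there (there (here refl)))))
∈-allV ((1F , 4F) , _) = there (there (there (there (there (there (here refl))))))
∈-allV ((2F , 3F) , _) = there (there (there (there (there (there (there (here refl)))))))
∈-allV ((2F , 4F) , _) = there (there (there (there (there (there (there (there (here refl))))))))
∈-allV ((3F , 4F) , _) = there (there (there (there (there (there (there (there (there (here refl)))))))))
∈-allV ((_ , 0F) , ())
∈-allV ((Fin.suc _ , 1F) , ())
∈-allV ((Fin.suc (Fin.suc _) , 2F) , ())
∈-allV ((Fin.suc (Fin.suc (Fin.suc _)) , 3F) , ())
∈-allV ((Fin.suc (Fin.suc (Fin.suc (Fin.suc _))) , 4F) , ())

isEdge? : ∀ e → Dec (IsEdge e)
isEdge? (v , w) = T? (adj v w)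

neighbours : V → List V
neighbours v = filter (T? ∘ adj v) allV

∈-neighbours : ∀ {v w} → Adjacent v w → w ∈ neighbours v
∈-neighbours {v} {w} vw = ∈-filter⁺ (T? ∘ adj v) (∈-allV w) vw

darts : List (V × V)
darts = filter isEdge? (cartesianProduct allV allV)

∈-darts : ∀ {e} → IsEdge e → e ∈ darts
∈-darts {v , w} vw = ∈-filter⁺ isEdge? (∈-cartesianProduct⁺ (∈-allV v) (∈-allV w)) vw

∈-darts⁻ : ∀ {e} → e ∈ darts → IsEdge e
∈-darts⁻ e∈ = proj₂ (∈-filter⁻ isEdge? {xs = cartesianProduct allV allV} e∈)

All-darts : ∀ {P : V × V → Set} → All P darts → ∀ e → IsEdge e → P e
All-darts P-darts _ e-edge = All.lookup P-darts (∈-darts e-edge)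

walksFrom : ℕ → V → List (List V)
walksFrom zero    v = [ [ v ] ]
walksFrom (suc n) v = concatMap (λ w → map (v ∷_) (walksFrom n w)) (neighbours v)

walks : ℕ → List (List V)
walks n = concatMap (walksFrom n) allV

∈-walksFrom : ∀ v vs → All IsEdge (walk v vs) → v ∷ vs ∈ walksFrom (length vs) v
∈-walksFrom v []       _           = here refl
∈-walksFrom v (w ∷ vs) (vw ∷ rest) =
  ∈-concatMap⁺ (λ u → map (v ∷_) (walksFrom (length vs) u))
    (Any.map (λ { refl → ∈-map⁺ (v ∷_) (∈-walksFrom w vs rest) }) (∈-neighbours {v} {w} vw))

All-walk-++ : ∀ {P : V × V → Set} a bs cs → All P (walk a (bs ++ cs)) → All P (walk a bs)
All-walk-++ a []       cs _          = []
All-walk-++ a (b ∷ bs) cs (pab ∷ ps) = pab ∷ All-walk-++ b bs cs ps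

cycle∈walks : ∀ {n} c → IsCycle (suc n) c → c ∈ walks n
cycle∈walks (x ∷ xs) (refl , _ , adjacent) =
  ∈-concatMap⁺ (walksFrom (length xs)) (Any.map (λ { refl → ∈-walksFrom x xs (All-walk-++ x xs [ x ] walk-adjacent) }) (∈-allV x))
  where
  walk-adjacent = subst (All IsEdge) (cyclePairs-walk x xs) adjacent

isCycle? : ∀ k c → Dec (IsCycle k c)
isCycle? k c = (length c ℕ.≟ k) ×-dec (unique? _≟ⱽ_ c ×-dec all? isEdge? (cyclePairs c))

sameEdge? : ∀ e v w → Dec (SameEdge e v w)
sameEdge? (a , b) v w = ((v ≟ⱽ a) ×-dec (w ≟ⱽ b)) ⊎-dec ((v ≟ⱽ b) ×-dec (w ≟ⱽ a))

negativeOn : List (V × V) → Signature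
negativeOn es v w = if does (any? (λ e → sameEdge? e v w) es) then minus else plus

negativeOn-minus : ∀ es v w → negativeOn es v w ≡ minus ⇔ Any (λ e → SameEdge e v w) es
negativeOn-minus es v w with any? (λ e → sameEdge? e v w) es
... | yes on-e = mk⇔ (λ _ → on-e) (λ _ → refl)
... | no ¬on-e = mk⇔ (λ ()) (⊥-elim ∘ ¬on-e)

negativeOn-symmetric : ∀ es → SymmetricEverywhere (negativeOn es)
negativeOn-symmetric es v w = sign-ext (⇔-sym (negativeOn-minus es w v) ⇔-∘ (flip-any ⇔-∘ negativeOn-minus es v w))
  where
  flip-any : Any (λ e → SameEdge e v w) es ⇔ Any (λ e → SameEdge e w v) es
  flip-any = mk⇔ (Any.map flip) (Any.map flip)
    where
    flip : ∀ {e v w} → SameEdge e v w → SameEdge e w v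
    flip = Sum.swap ∘ Sum.map swap swap

negativeEdgesAre-negativeOn : ∀ {es} → All IsEdge es → NegativeEdgesAre (negativeOn es) es
negativeEdgesAre-negativeOn {es} es-edges = es-edges , λ v w _ → negativeOn-minus es v w

negativeEdgesAre-agree : ∀ {σ σ′ es} → NegativeEdgesAre σ es → NegativeEdgesAre σ′ es → Agree σ σ′
negativeEdgesAre-agree (_ , σ-neg) (_ , σ′-neg) v w vw = sign-ext (⇔-sym (σ′-neg v w vw) ⇔-∘ σ-neg v w vw)

agree-negativeOn : ∀ {σ es} → NegativeEdgesAre σ es → Agree σ (negativeOn es)
agree-negativeOn σ-neg = negativeEdgesAre-agree σ-neg (negativeEdgesAre-negativeOn (proj₁ σ-neg))

cycleSign-agree : ∀ {σ σ′ k c} → Agree σ σ′ → IsCycle k c → cycleSign σ c ≡ cycleSign σ′ c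
cycleSign-agree σ≈σ′ (_ , _ , adjacent) = signOf-agree σ≈σ′ adjacent

numNegCycles-resp : ∀ {σ σ′ k n} → Agree σ σ′ → NumNegCycles σ k n → NumNegCycles σ′ k n
numNegCycles-resp σ≈σ′ (cs , length≡ , negative , distinct , complete) =
  cs , length≡ ,
  All.map (λ { (cyc , σ-minus) → cyc , trans (sym (cycleSign-agree σ≈σ′ cyc)) σ-minus }) negative ,
  distinct ,
  λ { c (cyc , σ′-minus) → complete c (cyc , trans (cycleSign-agree σ≈σ′ cyc) σ′-minus) }

negativeCycle? : ∀ σ c → Dec (cycleSign σ c ≡ minus)
negativeCycle? σ c = cycleSign σ c ≟ˢ minus

count : List (List V) → Signature → ℕ
count cycles σ = length (filter (negativeCycle? σ) cycles)

module _ {k} {cycles : List (List V)}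
  (cycles-are-cycles : All (IsCycle k) cycles)
  (cycles-distinct   : AllPairs (λ c d → ¬ SameCycle c d) cycles)
  (cycles-complete   : ∀ c → IsCycle k c → Any (_∈ variants c) cycles) where

  numNegCycles-count : ∀ σ → SymmetricEverywhere σ → NumNegCycles σ k (count cycles σ)
  numNegCycles-count σ σ-sym =
    filter (negativeCycle? σ) cycles , refl ,
    All.zip (All.filter⁺ (negativeCycle? σ) cycles-are-cycles , all-filter (negativeCycle? σ) cycles) ,
    AllPairs.filter⁺ (negativeCycle? σ) cycles-distinct ,
    complete
    where
    complete : ∀ c → NegCycle σ k c → Any (SameCycle c) (filter (negativeCycle? σ) cycles)
    complete c (cyc , c-minus) with find (cycles-complete c cyc)
    ... | r , r∈ , r∈variants =
      Any.map (λ { refl → sameCycle-variant {c} r∈variants })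
        (∈-filter⁺ (negativeCycle? σ) r∈ (trans (cycleSign-variant σ-sym {c} r∈variants) c-minus))

pentagons : List (List V)
pentagons =
    (v01 ∷ v23 ∷ v04 ∷ v12 ∷ v34 ∷ [])
  ∷ (v01 ∷ v23 ∷ v04 ∷ v13 ∷ v24 ∷ [])
  ∷ (v01 ∷ v23 ∷ v14 ∷ v02 ∷ v34 ∷ [])
  ∷ (v01 ∷ v23 ∷ v14 ∷ v03 ∷ v24 ∷ [])
  ∷ (v01 ∷ v24 ∷ v03 ∷ v12 ∷ v34 ∷ [])
  ∷ (v01 ∷ v24 ∷ v13 ∷ v02 ∷ v34 ∷ [])
  ∷ (v02 ∷ v13 ∷ v04 ∷ v12 ∷ v34 ∷ [])
  ∷ (v02 ∷ v13 ∷ v04 ∷ v23 ∷ v14 ∷ [])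
  ∷ (v02 ∷ v13 ∷ v24 ∷ v03 ∷ v14 ∷ [])
  ∷ (v02 ∷ v14 ∷ v03 ∷ v12 ∷ v34 ∷ [])
  ∷ (v03 ∷ v12 ∷ v04 ∷ v13 ∷ v24 ∷ [])
  ∷ (v03 ∷ v12 ∷ v04 ∷ v23 ∷ v14 ∷ [])
  ∷ []

hexagons : List (List V)
hexagons =
    (v01 ∷ v23 ∷ v04 ∷ v12 ∷ v03 ∷ v24 ∷ [])
  ∷ (v01 ∷ v23 ∷ v04 ∷ v13 ∷ v02 ∷ v34 ∷ [])
  ∷ (v01 ∷ v23 ∷ v14 ∷ v02 ∷ v13 ∷ v24 ∷ [])
  ∷ (v01 ∷ v23 ∷ v14 ∷ v03 ∷ v12 ∷ v34 ∷ [])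
  ∷ (v01 ∷ v24 ∷ v03 ∷ v14 ∷ v02 ∷ v34 ∷ [])
  ∷ (v01 ∷ v24 ∷ v13 ∷ v04 ∷ v12 ∷ v34 ∷ [])
  ∷ (v02 ∷ v13 ∷ v04 ∷ v12 ∷ v03 ∷ v14 ∷ [])
  ∷ (v02 ∷ v13 ∷ v24 ∷ v03 ∷ v12 ∷ v34 ∷ [])
  ∷ (v02 ∷ v14 ∷ v23 ∷ v04 ∷ v12 ∷ v34 ∷ [])
  ∷ (v03 ∷ v14 ∷ v23 ∷ v04 ∷ v13 ∷ v24 ∷ [])
  ∷ []

inPairs? : ∀ ps v w → Dec (InPairs ps v w)
inPairs? ps v w = ((v , w) ∈ᴾ? ps) ⊎-dec ((w , v) ∈ᴾ? ps)

HasEdgeNotIn : List V → List V → Set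
HasEdgeNotIn c d = Any (λ p → ¬ InCycle d (proj₁ p) (proj₂ p)) (cyclePairs c)

hasEdgeNotIn? : ∀ c d → Dec (HasEdgeNotIn c d)
hasEdgeNotIn? c d = any? (λ p → ¬? (inPairs? (cyclePairs d) (proj₁ p) (proj₂ p))) (cyclePairs c)

hasEdgeNotIn⇒¬SameCycle : ∀ {c d} → HasEdgeNotIn c d → ¬ SameCycle c d
hasEdgeNotIn⇒¬SameCycle c∖d c≈d with find c∖d
... | (v , w) , vw∈c , vw∉d = vw∉d (Equivalence.to (c≈d v w) (inj₁ vw∈c))

-- Facts certified by running a decision procedure are kept opaque: unfolding such a certificate
-- during later type checking re-runs the computation.
opaque
  pentagons-are-cycles : All (IsCycle 5) pentagons
  pentagons-are-cycles = from-yes (all? (isCycle? 5) pentagons)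

  hexagons-are-cycles : All (IsCycle 6) hexagons
  hexagons-are-cycles = from-yes (all? (isCycle? 6) hexagons)

  pentagons-distinct : AllPairs (λ c d → ¬ SameCycle c d) pentagons
  pentagons-distinct = AllPairs.map (λ {c} {d} → hasEdgeNotIn⇒¬SameCycle {c} {d}) (from-yes (allPairs? hasEdgeNotIn? pentagons))

  hexagons-distinct : AllPairs (λ c d → ¬ SameCycle c d) hexagons
  hexagons-distinct = AllPairs.map (λ {c} {d} → hasEdgeNotIn⇒¬SameCycle {c} {d}) (from-yes (allPairs? hasEdgeNotIn? hexagons))

  pentagonal-walks : All (λ c → IsCycle 5 c → Any (_∈ variants c) pentagons) (walks 4)
  pentagonal-walks = from-yes (all? (λ c → isCycle? 5 c →-dec any? (_∈ᶜ? variants c) pentagons) (walks 4))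

  hexagonal-walks : All (λ c → IsCycle 6 c → Any (_∈ variants c) hexagons) (walks 5)
  hexagonal-walks = from-yes (all? (λ c → isCycle? 6 c →-dec any? (_∈ᶜ? variants c) hexagons) (walks 5))

pentagons-complete : ∀ c → IsCycle 5 c → Any (_∈ variants c) pentagons
pentagons-complete c cyc = All.lookup pentagonal-walks (cycle∈walks c cyc) cyc

hexagons-complete : ∀ c → IsCycle 6 c → Any (_∈ variants c) hexagons
hexagons-complete c cyc = All.lookup hexagonal-walks (cycle∈walks c cyc) cyc

numNegPentagons : ∀ σ → SymmetricEverywhere σ → NumNegCycles σ 5 (count pentagons σ)
numNegPentagons = numNegCycles-count pentagons-are-cycles pentagons-distinct pentagons-complete

numNegHexagons : ∀ σ → SymmetricEverywhere σ → NumNegCycles σ 6 (count hexagons σ)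
numNegHexagons = numNegCycles-count hexagons-are-cycles hexagons-distinct hexagons-complete

Counts : List (V × V) → ℕ → ℕ → Set
Counts es n₅ n₆ = count pentagons (negativeOn es) ≡ n₅ × count hexagons (negativeOn es) ≡ n₆

counts? : ∀ es n₅ n₆ → Dec (Counts es n₅ n₆)
counts? es n₅ n₆ = (count pentagons (negativeOn es) ℕ.≟ n₅) ×-dec (count hexagons (negativeOn es) ℕ.≟ n₆)

numNegCycles-counts : ∀ {σ es n₅ n₆} → NegativeEdgesAre σ es → Counts es n₅ n₆ →
  NumNegCycles σ 5 n₅ × NumNegCycles σ 6 n₆
numNegCycles-counts {σ} {es} σ-neg (refl , refl) =
  numNegCycles-resp σ≈ (numNegPentagons (negativeOn es) (negativeOn-symmetric es)) ,
  numNegCycles-resp σ≈ (numNegHexagons (negativeOn es) (negativeOn-symmetric es))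
  where
  σ≈ : Agree (negativeOn es) σ
  σ≈ v w vw = sym (agree-negativeOn σ-neg v w vw)

disjoint? : ∀ e f → Dec (DisjointEdges e f)
disjoint? (a , b) (c , d) = ¬? (a ≟ⱽ c) ×-dec (¬? (a ≟ⱽ d) ×-dec (¬? (b ≟ⱽ c) ×-dec ¬? (b ≟ⱽ d)))

joined? : ∀ e f → Dec (Joined e f)
joined? (a , b) (c , d) = T? (adj a c) ⊎-dec (T? (adj a d) ⊎-dec (T? (adj b c) ⊎-dec T? (adj b d)))

dist2? : ∀ e f → Dec (Dist2 e f)
dist2? e f = disjoint? e f ×-dec joined? e f

dist3? : ∀ e f → Dec (Dist3 e f)
dist3? e f = disjoint? e f ×-dec ¬? (joined? e f)

alternateEdges : List V → List (V × V)
alternateEdges (a ∷ b ∷ vs) = (a , b) ∷ alternateEdges vs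
alternateEdges _            = []

opaque
  +P-counts : Counts [] 0 0
  +P-counts = from-yes (counts? [] 0 0)

  P₁-counts : All (λ e → Counts [ e ] 4 4) darts
  P₁-counts = from-yes (all? (λ e → counts? [ e ] 4 4) darts)

  P₂₂-counts : All (λ e → All (λ f → Dist2 e f → Counts (e ∷ f ∷ []) 6 6) darts) darts
  P₂₂-counts = from-yes (all? (λ e → all? (λ f → dist2? e f →-dec counts? (e ∷ f ∷ []) 6 6) darts) darts)

  P₂₃-counts : All (λ e → All (λ f → Dist3 e f → Counts (e ∷ f ∷ []) 8 4) darts) darts
  P₂₃-counts = from-yes (all? (λ e → all? (λ f → dist3? e f →-dec counts? (e ∷ f ∷ []) 8 4) darts) darts)

  P₃₃-counts : All (λ e → All (λ f → Dist3 e f → All (λ g → Dist3 e g → Dist3 f g →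
    Counts (e ∷ f ∷ g ∷ []) 12 0) darts) darts) darts
  P₃₃-counts = from-yes (all? (λ e → all? (λ f → dist3? e f →-dec all? (λ g → dist3? e g →-dec (dist3? f g →-dec
    counts? (e ∷ f ∷ g ∷ []) 12 0)) darts) darts) darts)

  P₃₂-counts : All (λ c → IsCycle 6 c → Counts (alternateEdges c) 6 10) (walks 5)
  P₃₂-counts = from-yes (all? (λ c → isCycle? 6 c →-dec counts? (alternateEdges c) 6 10) (walks 5))

record Automorphism : Set where
  field
    to from : V → V
    from-to : ∀ v → from (to v) ≡ v
    to-from : ∀ v → to (from v) ≡ v
    adj-to  : ∀ v w → adj (to v) (to w) ≡ adj v w

open Automorphism

idᴬ : Automorphism
idᴬ = record { to = λ v → v ; from = λ v → v ; from-to = λ _ → refl ; to-from = λ _ → refl ; adj-to = λ _ _ → refl }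

_∘ᴬ_ : Automorphism → Automorphism → Automorphism
φ ∘ᴬ ψ = record
  { to      = to φ ∘ to ψ
  ; from    = from ψ ∘ from φ
  ; from-to = λ v → trans (cong (from ψ) (from-to φ (to ψ v))) (from-to ψ v)
  ; to-from = λ v → trans (cong (to φ) (to-from ψ (from φ v))) (to-from φ v)
  ; adj-to  = λ v w → trans (adj-to φ (to ψ v) (to ψ w)) (adj-to ψ v w)
  }

_⁻¹ᴬ : Automorphism → Automorphism
φ ⁻¹ᴬ = record
  { to      = from φ
  ; from    = to φ
  ; from-to = to-from φ
  ; to-from = from-to φ
  ; adj-to  = λ v w → trans (sym (adj-to φ (from φ v) (from φ w))) (cong₂ adj (to-from φ v) (to-from φ w))
  }

adjacent-to : ∀ φ {v w} → Adjacent v w → Adjacent (to φ v) (to φ w)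
adjacent-to φ {v} {w} = subst T (sym (adj-to φ v w))

to-injective : ∀ φ {v w} → to φ v ≡ to φ w → v ≡ w
to-injective φ {v} {w} eq = trans (sym (from-to φ v)) (trans (cong (from φ) eq) (from-to φ w))

negativeOn-image : ∀ φ es v w →
  negativeOn (map (Product.map (to φ) (to φ)) es) (to φ v) (to φ w) ≡ negativeOn es v w
negativeOn-image φ es v w = sign-ext (⇔-sym (negativeOn-minus es v w) ⇔-∘ (any-image ⇔-∘ negativeOn-minus _ _ _))
  where
  sameEdge-image : ∀ {e} → SameEdge (Product.map (to φ) (to φ) e) (to φ v) (to φ w) ⇔ SameEdge e v w
  sameEdge-image = mk⇔
    (Sum.map (Product.map (to-injective φ) (to-injective φ)) (Product.map (to-injective φ) (to-injective φ)))
    (Sum.map (Product.map (cong (to φ)) (cong (to φ))) (Product.map (cong (to φ)) (cong (to φ))))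
  any-image : Any (λ e → SameEdge e (to φ v) (to φ w)) (map (Product.map (to φ) (to φ)) es) ⇔
              Any (λ e → SameEdge e v w) es
  any-image = mk⇔ (Any.map (Equivalence.to sameEdge-image) ∘ Any.map⁻) (Any.map⁺ ∘ Any.map (Equivalence.from sameEdge-image))

-- the vertex {x , y}; junk when x ≡ y
pairVertex : Fin 5 → Fin 5 → V
pairVertex x y with T? (toℕ x <ᵇ toℕ y)
... | yes x<y = (x , y) , x<y
... | no _ with T? (toℕ y <ᵇ toℕ x)
...   | yes y<x = (y , x) , y<x
...   | no _    = v01

relabel : (Fin 5 → Fin 5) → V → V
relabel f v = pairVertex (f (proj₁ (proj₁ v))) (f (proj₂ (proj₁ v)))

Unordered : Fin 5 × Fin 5 → Fin 5 → Fin 5 → Set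
Unordered p x y = p ≡ (x , y) ⊎ p ≡ (y , x)

unordered-map : ∀ {p x y} (f : Fin 5 → Fin 5) → Unordered p x y → Unordered (Product.map f f p) (f x) (f y)
unordered-map f (inj₁ refl) = inj₁ refl
unordered-map f (inj₂ refl) = inj₂ refl

ends-distinct : ∀ v → proj₁ (proj₁ v) ≢ proj₂ (proj₁ v)
ends-distinct ((i , j) , i<j) i≡j = ℕ.<⇒≢ (ℕ.<ᵇ⇒< (toℕ i) (toℕ j) i<j) (cong (toℕ {5}) i≡j)

pairVertex-ends : ∀ {x y} → x ≢ y → Unordered (proj₁ (pairVertex x y)) x y
pairVertex-ends {x} {y} x≢y with T? (toℕ x <ᵇ toℕ y)
... | yes _ = inj₁ refl
... | no x≮y with T? (toℕ y <ᵇ toℕ x)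
...   | yes _  = inj₂ refl
...   | no y≮x = ⊥-elim (x≢y (Fin.toℕ-injective (ℕ.≤-antisym (≮ᵇ⇒≥ y≮x) (≮ᵇ⇒≥ x≮y))))
  where
  ≮ᵇ⇒≥ : ∀ {m n} → ¬ T (m <ᵇ n) → n ≤ m
  ≮ᵇ⇒≥ m≮n = ℕ.≮⇒≥ (m≮n ∘ ℕ.<⇒<ᵇ)

pairVertex-unordered : ∀ {x y} v → Unordered (x , y) (proj₁ (proj₁ v)) (proj₂ (proj₁ v)) → pairVertex x y ≡ v
pairVertex-unordered ((i , j) , i<j) (inj₁ refl) with T? (toℕ i <ᵇ toℕ j)
... | yes i<j′ = cong ((i , j) ,_) (T-irrelevant i<j′ i<j)
... | no i≮j   = ⊥-elim (i≮j i<j)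
pairVertex-unordered ((i , j) , i<j) (inj₂ refl) with T? (toℕ j <ᵇ toℕ i)
... | yes j<i = ⊥-elim (ℕ.<-asym (ℕ.<ᵇ⇒< (toℕ i) (toℕ j) i<j) (ℕ.<ᵇ⇒< (toℕ j) (toℕ i) j<i))
... | no _ with T? (toℕ i <ᵇ toℕ j)
...   | yes i<j′ = cong ((i , j) ,_) (T-irrelevant i<j′ i<j)
...   | no i≮j   = ⊥-elim (i≮j i<j)

disjointᵇ : Fin 5 × Fin 5 → Fin 5 × Fin 5 → Bool
disjointᵇ (i , j) (k , l) = (i ≠ᵇ k) ∧ (i ≠ᵇ l) ∧ (j ≠ᵇ k) ∧ (j ≠ᵇ l)

disjointᵇ-swapˡ : ∀ x y q → disjointᵇ (y , x) q ≡ disjointᵇ (x , y) q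
disjointᵇ-swapˡ x y (z , w) = begin
  a ∧ b ∧ c ∧ d    ≡⟨ ∧-assoc a b (c ∧ d) ⟨
  (a ∧ b) ∧ c ∧ d  ≡⟨ ∧-comm (a ∧ b) (c ∧ d) ⟩
  (c ∧ d) ∧ a ∧ b  ≡⟨ ∧-assoc c d (a ∧ b) ⟩
  c ∧ d ∧ a ∧ b    ∎
  where
  open ≡-Reasoning
  a = y ≠ᵇ z; b = y ≠ᵇ w; c = x ≠ᵇ z; d = x ≠ᵇ w

disjointᵇ-swapʳ : ∀ p z w → disjointᵇ p (w , z) ≡ disjointᵇ p (z , w)
disjointᵇ-swapʳ (x , y) z w = begin
  b ∧ a ∧ d ∧ c    ≡⟨ ∧-assoc b a (d ∧ c) ⟨
  (b ∧ a) ∧ d ∧ c  ≡⟨ cong₂ _∧_ (∧-comm b a) (∧-comm d c) ⟩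
  (a ∧ b) ∧ c ∧ d  ≡⟨ ∧-assoc a b (c ∧ d) ⟩
  a ∧ b ∧ c ∧ d    ∎
  where
  open ≡-Reasoning
  a = x ≠ᵇ z; b = x ≠ᵇ w; c = y ≠ᵇ z; d = y ≠ᵇ w

disjointᵇ-unordered : ∀ {p q x y z w} → Unordered p x y → Unordered q z w →
  disjointᵇ p q ≡ disjointᵇ (x , y) (z , w)
disjointᵇ-unordered                 (inj₁ refl) (inj₁ refl) = refl
disjointᵇ-unordered {x = x} {y}     (inj₂ refl) (inj₁ refl) = disjointᵇ-swapˡ x y _
disjointᵇ-unordered {x = x} {y} {z} {w} (inj₁ refl) (inj₂ refl) = disjointᵇ-swapʳ (x , y) z w
disjointᵇ-unordered {x = x} {y} {z} {w} (inj₂ refl) (inj₂ refl) =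
  trans (disjointᵇ-swapˡ x y (w , z)) (disjointᵇ-swapʳ (x , y) z w)

≠ᵇ-injective : ∀ {f : Fin 5 → Fin 5} → Injective _≡_ _≡_ f → ∀ x y → (f x ≠ᵇ f y) ≡ (x ≠ᵇ y)
≠ᵇ-injective {f} f-inj x y with x Fin.≟ y | f x Fin.≟ f y
... | yes _    | yes _     = refl
... | no _     | no _      = refl
... | yes refl | no fx≢fx  = ⊥-elim (fx≢fx refl)
... | no x≢y   | yes fx≡fy = ⊥-elim (x≢y (f-inj fx≡fy))

inverseˡ⇒injective : ∀ {f g : Fin 5 → Fin 5} → (∀ x → g (f x) ≡ x) → Injective _≡_ _≡_ f
inverseˡ⇒injective {g = g} gf {x} {y} fx≡fy = trans (sym (gf x)) (trans (cong g fx≡fy) (gf y))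

relabel-ends : ∀ {f} → Injective _≡_ _≡_ f → ∀ v →
  Unordered (proj₁ (relabel f v)) (f (proj₁ (proj₁ v))) (f (proj₂ (proj₁ v)))
relabel-ends f-inj v = pairVertex-ends (λ fi≡fj → ends-distinct v (f-inj fi≡fj))

relabel-inverse : ∀ {f g} → (∀ x → g (f x) ≡ x) → ∀ v → relabel g (relabel f v) ≡ v
relabel-inverse {f} {g} gf v = pairVertex-unordered v
  (subst₂ (Unordered _) (gf _) (gf _) (unordered-map g (relabel-ends {f} (inverseˡ⇒injective {f} {g} gf) v)))

adj-relabel : ∀ {f} → Injective _≡_ _≡_ f → ∀ v w → adj (relabel f v) (relabel f w) ≡ adj v w
adj-relabel {f} f-inj v@((i , j) , _) w@((k , l) , _) = begin
  adj (relabel f v) (relabel f w)      ≡⟨ disjointᵇ-unordered (relabel-ends f-inj v) (relabel-ends f-inj w) ⟩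
  disjointᵇ (f i , f j) (f k , f l)    ≡⟨ cong₂ _∧_ (≠ i k) (cong₂ _∧_ (≠ i l) (cong₂ _∧_ (≠ j k) (≠ j l))) ⟩
  adj v w                              ∎
  where
  open ≡-Reasoning
  ≠ = ≠ᵇ-injective {f} f-inj

relabelling : (f g : Fin 5 → Fin 5) → (∀ x → g (f x) ≡ x) → (∀ x → f (g x) ≡ x) → Automorphism
relabelling f g gf fg = record
  { to      = relabel f
  ; from    = relabel g
  ; from-to = relabel-inverse {f} {g} gf
  ; to-from = relabel-inverse {g} {f} fg
  ; adj-to  = adj-relabel {f} (inverseˡ⇒injective {f} {g} gf)
  }

invert : (Fin 5 → Fin 5) → Fin 5 → Fin 5
invert f y = fromMaybe 0F (first (λ x → f x Fin.≟ y) (allFin 5))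

-- the point of {0,…,4} on neither end of the dart; junk when there is none
outside : V × V → Fin 5
outside (((i , j) , _) , ((k , l) , _)) = fromMaybe 0F (first (_∉ᶠ? (i ∷ j ∷ k ∷ l ∷ [])) (allFin 5))

standardLabel : V × V → Fin 5 → Fin 5
standardLabel (((i , _) , _) , _) 0F = i
standardLabel (((_ , j) , _) , _) 1F = j
standardLabel (_ , ((k , _) , _)) 2F = k
standardLabel (_ , ((_ , l) , _)) 3F = l
standardLabel e                   4F = outside e

StandardLabel : V × V → Set
StandardLabel e = All (λ x → invert f (f x) ≡ x × f (invert f x) ≡ x) (allFin 5) ×
                  relabel f v01 ≡ proj₁ e × relabel f v23 ≡ proj₂ e
  where
  f = standardLabel e

opaque
  standardLabels : All StandardLabel darts
  standardLabels = from-yes (all? (λ e → let f = standardLabel e in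
    all? (λ x → (invert f (f x) Fin.≟ x) ×-dec (f (invert f x) Fin.≟ x)) (allFin 5) ×-dec
    ((relabel f v01 ≟ⱽ proj₁ e) ×-dec (relabel f v23 ≟ⱽ proj₂ e))) darts)

standardPosition : ∀ {a b} → Adjacent a b → Σ Automorphism λ φ → to φ v01 ≡ a × to φ v23 ≡ b
standardPosition {a} {b} ab = relabelling f (invert f) (proj₁ ∘ bijective) (proj₂ ∘ bijective) , proj₂ labelled
  where
  f : Fin 5 → Fin 5
  f = standardLabel (a , b)
  labelled : StandardLabel (a , b)
  labelled = All-darts standardLabels (a , b) ab
  bijective : ∀ x → invert f (f x) ≡ x × f (invert f x) ≡ x
  bijective x = All.lookup (proj₁ labelled) (∈-allFin x)

edge-transitive : ∀ {a b c d} → Adjacent a b → Adjacent c d → Σ Automorphism λ φ → to φ a ≡ c × to φ b ≡ d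
edge-transitive ab cd with standardPosition ab | standardPosition cd
... | φ , φ01 , φ23 | ψ , ψ01 , ψ23 = ψ ∘ᴬ (φ ⁻¹ᴬ) , through {φ} {ψ} φ01 ψ01 , through {φ} {ψ} φ23 ψ23
  where
  through : ∀ {φ ψ u x y} → to φ u ≡ x → to ψ u ≡ y → to ψ (from φ x) ≡ y
  through {φ} {ψ} {u} refl ψu = trans (cong (to ψ) (from-to φ u)) ψu

_switchedBy_ : Signature → (V → Sign) → Signature
(σ switchedBy ζ) v w = (ζ v · σ v w) · ζ w

switchingAvoiding : Fin 5 → V → Sign
switchingAvoiding m ((i , j) , _) = if does ((m Fin.≟ i) ⊎-dec (m Fin.≟ j)) then plus else minus

SwitchesTo : List (V × V) → (V → Sign) → Signature → Set
SwitchesTo es ζ τ = All (λ d → (negativeOn es switchedBy ζ) (proj₁ d) (proj₂ d) ≡ τ (proj₁ d) (proj₂ d)) darts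

switchesTo? : ∀ es ζ τ → Dec (SwitchesTo es ζ τ)
switchesTo? es ζ τ = all? (λ d → (negativeOn es switchedBy ζ) (proj₁ d) (proj₂ d) ≟ˢ τ (proj₁ d) (proj₂ d)) darts

switchingIsomorphic : ∀ {σ τ} ζ φ → (∀ v w → Adjacent v w → τ (to φ v) (to φ w) ≡ (σ switchedBy ζ) v w) →
  SwitchingIsomorphic σ τ
switchingIsomorphic ζ φ τ∘φ≡σᶻ = ζ , to φ , from φ , from-to φ , to-from φ , adj-to φ , τ∘φ≡σᶻ

switchedBy-agree : ∀ {σ σ′} ζ → Agree σ σ′ → Agree (σ switchedBy ζ) (σ′ switchedBy ζ)
switchedBy-agree ζ σ≈σ′ v w vw = cong (λ s → (ζ v · s) · ζ w) (σ≈σ′ v w vw)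

opaque
  P₃₃-switches : All (λ e → All (λ f → Dist3 e f → All (λ g → Dist3 e g → Dist3 f g →
    SwitchesTo (e ∷ f ∷ g ∷ []) (switchingAvoiding (outside e)) (λ _ _ → minus)) darts) darts) darts
  P₃₃-switches = from-yes (all? (λ e → all? (λ f → dist3? e f →-dec all? (λ g → dist3? e g →-dec (dist3? f g →-dec
    switchesTo? (e ∷ f ∷ g ∷ []) (switchingAvoiding (outside e)) (λ _ _ → minus))) darts) darts) darts)

  P₂₃-switches : All (λ e → All (λ f → Dist3 e f → Any (λ g →
    SwitchesTo (e ∷ f ∷ []) (switchingAvoiding (outside e)) (negSig (negativeOn [ g ]))) darts) darts) darts
  P₂₃-switches = from-yes (all? (λ e → all? (λ f → dist3? e f →-dec any? (λ g →
    switchesTo? (e ∷ f ∷ []) (switchingAvoiding (outside e)) (negSig (negativeOn [ g ]))) darts) darts) darts)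

plus≢minus : plus ≢ minus
plus≢minus ()

allPositive⇒noNegativeEdges : ∀ {σ} → IsPlusP σ → NegativeEdgesAre σ []
allPositive⇒noNegativeEdges σ⁺ = [] , λ v w vw → mk⇔ (λ σ-minus → ⊥-elim (plus≢minus (trans (sym (σ⁺ v w vw)) σ-minus))) (λ ())

+P-numbers : ∀ σ → Symmetric σ → IsPlusP σ → NumNegCycles σ 5 0 × NumNegCycles σ 6 0
+P-numbers σ _ σ⁺ = numNegCycles-counts (allPositive⇒noNegativeEdges σ⁺) +P-counts

P₁-numbers : ∀ σ → Symmetric σ → IsP1 σ → NumNegCycles σ 5 4 × NumNegCycles σ 6 4
P₁-numbers σ _ (e , σ-neg@(e-edge ∷ [] , _)) = numNegCycles-counts σ-neg (All-darts P₁-counts e e-edge)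

P₂₂-numbers : ∀ σ → Symmetric σ → IsP22 σ → NumNegCycles σ 5 6 × NumNegCycles σ 6 6
P₂₂-numbers σ _ (e , f , e∼f , σ-neg@(e-edge ∷ f-edge ∷ [] , _)) =
  numNegCycles-counts σ-neg (All-darts (All-darts P₂₂-counts e e-edge) f f-edge e∼f)

P₂₃-numbers : ∀ σ → Symmetric σ → IsP23 σ → NumNegCycles σ 5 8 × NumNegCycles σ 6 4
P₂₃-numbers σ _ (e , f , e∼f , σ-neg@(e-edge ∷ f-edge ∷ [] , _)) =
  numNegCycles-counts σ-neg (All-darts (All-darts P₂₃-counts e e-edge) f f-edge e∼f)

P₃₂-numbers : ∀ σ → Symmetric σ → IsP32 σ → NumNegCycles σ 5 6 × NumNegCycles σ 6 10
P₃₂-numbers σ _ (_ , _ , _ , _ , _ , _ , hexagon , σ-neg) =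
  numNegCycles-counts σ-neg (All.lookup P₃₂-counts (cycle∈walks _ hexagon) hexagon)

P₃₃-numbers : ∀ σ → Symmetric σ → IsP33 σ → NumNegCycles σ 5 12 × NumNegCycles σ 6 0
P₃₃-numbers σ _ (e , f , g , e∼f , e∼g , f∼g , σ-neg@(e-edge ∷ f-edge ∷ g-edge ∷ [] , _)) =
  numNegCycles-counts σ-neg (All-darts (All-darts (All-darts P₃₃-counts e e-edge) f f-edge e∼f) g g-edge e∼g f∼g)

P₂₃≃-P₁ : ∀ σ τ → Symmetric σ → Symmetric τ → IsP23 σ → IsMinusP1 τ → SwitchingIsomorphic σ τ
P₂₃≃-P₁ σ τ _ _ (e , f , e∼f , σ-neg@(e-edge ∷ f-edge ∷ [] , _)) (h , τ-neg@(h-edge ∷ [] , _))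
  with find (All-darts (All-darts P₂₃-switches e e-edge) f f-edge e∼f)
... | g , g∈darts , switches with edge-transitive {c = proj₁ h} {proj₂ h} (∈-darts⁻ g∈darts) h-edge
... | φ , g₁↦h₁ , g₂↦h₂ = switchingIsomorphic {σ} {τ} ζ φ λ v w vw → begin
    τ (to φ v) (to φ w)                         ≡⟨ neg-involutive _ ⟨
    neg (negSig τ (to φ v) (to φ w))            ≡⟨ cong neg (agree-negativeOn τ-neg _ _ (adjacent-to φ vw)) ⟩
    neg (negativeOn [ h ] (to φ v) (to φ w))    ≡⟨ cong₂ (λ (x y : V) → neg (negativeOn [ (x , y) ] (to φ v) (to φ w))) g₁↦h₁ g₂↦h₂ ⟨
    neg (negativeOn (map (Product.map (to φ) (to φ)) [ g ]) (to φ v) (to φ w))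
                                                ≡⟨ cong neg (negativeOn-image φ [ g ] v w) ⟩
    neg (negativeOn [ g ] v w)                  ≡⟨ All-darts switches (v , w) vw ⟨
    (negativeOn (e ∷ f ∷ []) switchedBy ζ) v w  ≡⟨ switchedBy-agree ζ (agree-negativeOn σ-neg) v w vw ⟨
    (σ switchedBy ζ) v w                        ∎
  where
  open ≡-Reasoning
  ζ = switchingAvoiding (outside e)

P₃₃≃-P : ∀ σ τ → Symmetric σ → Symmetric τ → IsP33 σ → IsMinusP τ → SwitchingIsomorphic σ τ
P₃₃≃-P σ τ _ _ (e , f , g , e∼f , e∼g , f∼g , σ-neg@(e-edge ∷ f-edge ∷ g-edge ∷ [] , _)) τ⁻ =
  switchingIsomorphic {σ} {τ} ζ idᴬ λ v w vw → begin
    τ v w                                           ≡⟨ τ⁻ v w vw ⟩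
    minus                                           ≡⟨ All-darts switches (v , w) vw ⟨
    (negativeOn (e ∷ f ∷ g ∷ []) switchedBy ζ) v w  ≡⟨ switchedBy-agree ζ (agree-negativeOn σ-neg) v w vw ⟨
    (σ switchedBy ζ) v w                            ∎
  where
  open ≡-Reasoning
  ζ = switchingAvoiding (outside e)
  switches = All-darts (All-darts (All-darts P₃₃-switches e e-edge) f f-edge e∼f) g g-edge e∼g f∼g

theorem6p1 : (∀ σ → Symmetric σ → IsPlusP σ → NumNegCycles σ 5 0 × NumNegCycles σ 6 0) ×
    (∀ σ → Symmetric σ → IsP1 σ → NumNegCycles σ 5 4 × NumNegCycles σ 6 4) ×
    (∀ σ → Symmetric σ → IsP22 σ → NumNegCycles σ 5 6 × NumNegCycles σ 6 6) ×
    (∀ σ → Symmetric σ → IsP23 σ → NumNegCycles σ 5 8 × NumNegCycles σ 6 4) ×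
    (∀ σ τ → Symmetric σ → Symmetric τ → IsP23 σ → IsMinusP1 τ → SwitchingIsomorphic σ τ) ×
    (∀ σ → Symmetric σ → IsP32 σ → NumNegCycles σ 5 6 × NumNegCycles σ 6 10) ×
    (∀ σ → Symmetric σ → IsP33 σ → NumNegCycles σ 5 12 × NumNegCycles σ 6 0) ×
    (∀ σ τ → Symmetric σ → Symmetric τ → IsP33 σ → IsMinusP τ → SwitchingIsomorphic σ τ)
theorem6p1 =
  +P-numbers , P₁-numbers , P₂₂-numbers , P₂₃-numbers , P₂₃≃-P₁ , P₃₂-numbers , P₃₃-numbers , P₃₃≃-P
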